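{- For any field $\mathbb{F}$, any positive integer $n$, and any subset $S\subseteq\mathbb{F}$ of size $|S|\geq 2$, the set $S^n\subseteq\mathbb{F}^n$ is $(1/|S|)$-dispersed.
   Context: For $0<c<1$, a set $T\subseteq\mathbb{F}^n$ is called $c$-dispersed if every linear subspace $V\subseteq\mathbb{F}^n$ satisfies $|V\cap T|\leq c^{n-\dim V}\cdot|T|$. -}

module Defs where

open import Level using (Level; _⊔_) renaming (suc to lsuc)
open import Algebra.Bundles using (CommutativeRing)
open import Data.Nat as ℕ using (ℕ; zero; suc; _∸_)
open import Data.Integer using (+_)
open import Data.Rational as ℚ using (ℚ; 0ℚ; 1ℚ; _/_)
open import Data.Fin using (Fin)
open import Data.Product using (Σ; ∃; _×_)
open import Data.List using (List; []; _∷_; [_]; map; concatMap; length)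
open import Data.List.Relation.Unary.All using (All)
open import Data.List.Relation.Unary.Any using (Any)
open import Data.List.Relation.Unary.AllPairs using (AllPairs)
import Data.Vec.Functional as VF
open import Relation.Nullary using (¬_)

record Field (c ℓ : Level) : Set (lsuc (c ⊔ ℓ)) where
  field
    commutativeRing : CommutativeRing c ℓ
  open CommutativeRing commutativeRing public
  field
    0≉1     : ¬ (0# ≈ 1#)
    inverse : ∀ x → ¬ (x ≈ 0#) → Σ Carrier (λ y → x * y ≈ 1#)

ℕ→ℚ : ℕ → ℚ
ℕ→ℚ m = + m / 1

_^ℚ_ : ℚ → ℕ → ℚ
q ^ℚ zero  = 1ℚ
q ^ℚ suc k = q ℚ.* (q ^ℚ k)

-- 1/k as a rational (only used for k ≥ 2; value 0 at k = 0 is a dummy)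
recipℕ : ℕ → ℚ
recipℕ zero    = 0ℚ
recipℕ (suc k) = + 1 / suc k

module LinearAlgebra {c ℓ : Level} (F : Field c ℓ) where
  open Field F

  Vecᶠ : ℕ → Set c
  Vecᶠ n = Fin n → Carrier

  _≈ᵛ_ : ∀ {n} → Vecᶠ n → Vecᶠ n → Set ℓ
  u ≈ᵛ v = ∀ i → u i ≈ v i

  0ᵛ : ∀ {n} → Vecᶠ n
  0ᵛ _ = 0#

  _+ᵛ_ : ∀ {n} → Vecᶠ n → Vecᶠ n → Vecᶠ n
  (u +ᵛ v) i = u i + v i

  _·ᵛ_ : ∀ {n} → Carrier → Vecᶠ n → Vecᶠ n
  (a ·ᵛ v) i = a * v i

  lincomb : ∀ {n d} → (Fin d → Carrier) → (Fin d → Vecᶠ n) → Vecᶠ n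
  lincomb {d = zero}  a b = 0ᵛ
  lincomb {d = suc d} a b = (a Fin.zero ·ᵛ b Fin.zero) +ᵛ lincomb (λ i → a (Fin.suc i)) (λ i → b (Fin.suc i))
    where import Data.Fin as Fin

  record IsSubspace {n : ℕ} (V : Vecᶠ n → Set (c ⊔ ℓ)) : Set (c ⊔ ℓ) where
    field
      resp  : ∀ {u v} → u ≈ᵛ v → V u → V v
      zero∈ : V 0ᵛ
      +-closed : ∀ {u v} → V u → V v → V (u +ᵛ v)
      ·-closed : ∀ a {v} → V v → V (a ·ᵛ v)

  LinearlyIndependent : ∀ {n d} → (Fin d → Vecᶠ n) → Set (c ⊔ ℓ)
  LinearlyIndependent b = ∀ a → lincomb a b ≈ᵛ 0ᵛ → ∀ i → a i ≈ 0#

  InSpan : ∀ {n d} → (Fin d → Vecᶠ n) → Vecᶠ n → Set (c ⊔ ℓ)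
  InSpan b v = Σ (Fin _ → Carrier) (λ a → v ≈ᵛ lincomb a b)

  IsBasis : ∀ {n d} → (Vecᶠ n → Set (c ⊔ ℓ)) → (Fin d → Vecᶠ n) → Set (c ⊔ ℓ)
  IsBasis V b = (∀ i → V (b i)) × LinearlyIndependent b × (∀ v → V v → InSpan b v)

  HasDim : ∀ {n} → (Vecᶠ n → Set (c ⊔ ℓ)) → ℕ → Set (c ⊔ ℓ)
  HasDim {n} V d = Σ (Fin d → Vecᶠ n) (λ b → IsBasis V b)

  _∈ᵛ_ : ∀ {n} → Vecᶠ n → List (Vecᶠ n) → Set (c ⊔ ℓ)
  v ∈ᵛ T = Any (λ w → v ≈ᵛ w) T

  Distinct : List Carrier → Set (c ⊔ ℓ)
  Distinct = AllPairs (λ x y → ¬ (x ≈ y))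

  Distinctᵛ : ∀ {n} → List (Vecᶠ n) → Set (c ⊔ ℓ)
  Distinctᵛ = AllPairs (λ u v → ¬ (u ≈ᵛ v))

  cube : List Carrier → (n : ℕ) → List (Vecᶠ n)
  cube S zero    = [ VF.[] ]
  cube S (suc n) = concatMap (λ s → map (λ f → s VF.∷ f) (cube S n)) S

  -- The finite set T is a repetition-free list; |V ∩ T| ≤ q is expressed as
  -- "every repetition-free list of elements of V ∩ T has length ≤ q".
  Dispersed : ∀ {n} → ℚ → List (Vecᶠ n) → Set (lsuc (c ⊔ ℓ))
  Dispersed {n} γ T =
    ∀ (V : Vecᶠ n → Set (c ⊔ ℓ)) → IsSubspace V →
    ∀ d → HasDim V d →
    ∀ (L : List (Vecᶠ n)) → Distinctᵛ L → All (λ x → V x × x ∈ᵛ T) L →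
    ℕ→ℚ (length L) ℚ.≤ (γ ^ℚ (n ∸ d)) ℚ.* ℕ→ℚ (length T)

module Submission where

-- Any affine span w + ⟨b₁, …, b_d⟩ meets S^n in
-- at most |S|^d points, by induction on n.  If every b_j has first coordinate
-- 0, the first coordinate is constant on the span, and one passes to tails.
-- Otherwise a pivot b_j with invertible first coordinate eliminates one vector:
-- the points with first coordinate σ have tails in an affine span of d − 1
-- vectors, and σ ranges over S.  Together with the trivial bound |S|^n this
-- gives |V ∩ S^n| ≤ |S|^min(d,n) = |S|^-(n ∸ d) · |S|^n.

open import Defs
open import Level using (Level; _⊔_)
open import Data.Nat using (ℕ; _≤_)
open import Data.List using (List; length)

open import Function using (_∘_)
import Data.Nat as ℕ
open import Data.Nat using (zero; suc; z≤n; s≤s; _^_; _∸_; _≤?_; NonZero; >-nonZero)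
open import Data.Nat.Properties
  using (≤-trans; +-mono-≤; +-suc; m^n>0; ^-distribˡ-+-*; m∸n+n≡m; m≤n⇒m∸n≡0; ≰⇒>; <⇒≤; module ≤-Reasoning)
open import Data.List using ([]; _∷_; map; concatMap)
open import Data.List.Properties using (length-map; length-++)
open import Data.List.Relation.Unary.All as All using (All; []; _∷_)
open import Data.List.Relation.Unary.All.Properties using (map⁺)
open import Data.List.Relation.Unary.Any as Any using (Any)
open import Data.List.Relation.Unary.Any.Properties using (concatMap⁻; map⁻)
open import Data.List.Relation.Unary.AllPairs using (AllPairs; []; _∷_)
open import Data.List.Relation.Binary.Sublist.Propositional using (_⊆_; []; _∷_; _∷ʳ_; ⊆-trans)
open import Data.List.Relation.Binary.Sublist.Propositional.Properties using (All-resp-⊆)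
open import Data.Fin using (Fin; zero; suc; punchIn)
open import Data.Vec.Functional as VF using (head; tail)
open import Data.Product using (Σ; ∃; _×_; _,_; proj₁; proj₂)
open import Data.Empty using (⊥-elim)
open import Data.Sum using (_⊎_; inj₁; inj₂; [_,_])
open import Relation.Nullary using (¬_; Dec; yes; no)
open import Relation.Nullary.Negation using (¬¬-map)
open import Relation.Nullary.Decidable using (decidable-stable; ¬¬-excluded-middle)
open import Relation.Binary.PropositionalEquality as ≡ using (_≡_)
import Algebra.Solver.Ring.NaturalCoefficients.Default as SemiringSolver
open import Algebra.Bundles using (CommutativeMonoid)
open import Data.Integer using (+_)
import Data.Integer as ℤ
import Data.Integer.Properties as ℤ
open import Data.Rational using (mkℚ)
import Data.Rational as ℚ
import Data.Rational.Properties as ℚ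
import Data.Nat.Coprimality as Coprime
import Algebra.Properties.CommutativeSemigroup as CommutativeSemigroupProperties
import Algebra.Properties.Ring as RingProperties

AllPairs-resp-⊆ : ∀ {a r} {A : Set a} {R : A → A → Set r} {xs ys : List A} → xs ⊆ ys → AllPairs R ys → AllPairs R xs
AllPairs-resp-⊆ []               []         = []
AllPairs-resp-⊆ (_ ∷ʳ xs⊆ys)     (_ ∷ rys)  = AllPairs-resp-⊆ xs⊆ys rys
AllPairs-resp-⊆ (≡.refl ∷ xs⊆ys) (rx ∷ rys) = All-resp-⊆ xs⊆ys rx ∷ AllPairs-resp-⊆ xs⊆ys rys

module _ {a} {A : Set a} where

  record Partition {p} (P : A → Set p) (xs : List A) : Set (a ⊔ p) where
    field
      sat unsat        : List A
      sat⊆             : sat ⊆ xs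
      unsat⊆           : unsat ⊆ xs
      all-sat          : All P sat
      all-unsat        : All (¬_ ∘ P) unsat
      length-partition : length xs ≡ length sat ℕ.+ length unsat

  -- Field equality is undecidable, so case splits on it are made classically;
  -- this is sound because every goal they serve is a decidable inequality in ℕ.
  ¬¬-partition : ∀ {p} (P : A → Set p) (xs : List A) → ¬ ¬ Partition P xs
  ¬¬-partition P [] k = k (record
    { sat = []; unsat = []; sat⊆ = []; unsat⊆ = []; all-sat = []; all-unsat = []; length-partition = ≡.refl })
  ¬¬-partition P (x ∷ xs) k = ¬¬-excluded-middle λ x? → ¬¬-partition P xs (k ∘ extend x?)
    where
    extend : Dec (P x) → Partition P xs → Partition P (x ∷ xs)
    extend (yes px) π = record
      { sat = x ∷ sat; unsat = unsat; sat⊆ = ≡.refl ∷ sat⊆; unsat⊆ = x ∷ʳ unsat⊆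
      ; all-sat = px ∷ all-sat; all-unsat = all-unsat; length-partition = ≡.cong suc length-partition }
      where open Partition π
    extend (no ¬px) π = record
      { sat = sat; unsat = x ∷ unsat; sat⊆ = x ∷ʳ sat⊆; unsat⊆ = ≡.refl ∷ unsat⊆
      ; all-sat = all-sat; all-unsat = ¬px ∷ all-unsat
      ; length-partition = ≡.trans (≡.cong suc length-partition) (≡.sym (+-suc _ _)) }
      where open Partition π

  length-≤-fibres : ∀ {k p} {K : Set k} (P : K → A → Set p) (keys : List K) {m : ℕ} (xs : List A) →
                    All (λ x → Any (λ κ → P κ x) keys) xs →
                    (∀ κ {ys} → ys ⊆ xs → All (P κ) ys → length ys ≤ m) →
                    length xs ≤ length keys ℕ.* m
  length-≤-fibres P []          []      _          _     = z≤n
  length-≤-fibres P []          (_ ∷ _) (() ∷ _)   _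
  length-≤-fibres P (κ ∷ keys) {m} xs covered fibre =
    decidable-stable (_ ≤? _) (¬¬-map bound (¬¬-partition (P κ) xs))
    where
    bound : Partition (P κ) xs → length xs ≤ m ℕ.+ length keys ℕ.* m
    bound π = begin
      length xs                   ≡⟨ length-partition ⟩
      length sat ℕ.+ length unsat ≤⟨ +-mono-≤ (fibre κ sat⊆ all-sat) rest ⟩
      m ℕ.+ length keys ℕ.* m     ∎
      where
      open Partition π
      open ≤-Reasoning
      rest : length unsat ≤ length keys ℕ.* m
      rest = length-≤-fibres P keys unsat
        (All.zipWith (λ (κ-or-keys , ¬Pκ) → Any.tail ¬Pκ κ-or-keys) (All-resp-⊆ unsat⊆ covered , all-unsat))
        (λ κ′ ys⊆unsat → fibre κ′ (⊆-trans ys⊆unsat unsat⊆))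

¬¬-all-or-counterexample : ∀ {p d} (P : Fin d → Set p) → ¬ ¬ ((∀ j → P j) ⊎ ∃ λ j → ¬ P j)
¬¬-all-or-counterexample {d = zero}  P k = k (inj₁ λ ())
¬¬-all-or-counterexample {d = suc d} P k = ¬¬-excluded-middle λ where
  (no ¬P0)  → k (inj₂ (zero , ¬P0))
  (yes P0)  → ¬¬-all-or-counterexample (P ∘ suc) λ where
    (inj₁ Psuc)       → k (inj₁ λ { zero → P0 ; (suc j) → Psuc j })
    (inj₂ (j , ¬Pj)) → k (inj₂ (suc j , ¬Pj))

module _ {c ℓ : Level} (F : Field c ℓ) where
  open Field F hiding (zero)
  open LinearAlgebra F
  open SemiringSolver commutativeSemiring using (solve; _:=_; _:+_; _:*_)
  open CommutativeSemigroupProperties +-commutativeSemigroup using (xy∙z≈xz∙y; interchange)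
  open RingProperties ring using (-‿distribʳ-*; -‿+-comm)

  record IsLinearMap {m n} (f : Vecᶠ m → Vecᶠ n) : Set (c ⊔ ℓ) where
    field
      map-0ᵛ : f 0ᵛ ≈ᵛ 0ᵛ
      map-+ᵛ : ∀ u v → f (u +ᵛ v) ≈ᵛ (f u +ᵛ f v)
      map-·ᵛ : ∀ x v → f (x ·ᵛ v) ≈ᵛ (x ·ᵛ f v)

  lincomb-map : ∀ {m n d} {f : Vecᶠ m → Vecᶠ n} → IsLinearMap f →
                (a : Fin d → Carrier) (b : Fin d → Vecᶠ m) → f (lincomb a b) ≈ᵛ lincomb a (f ∘ b)
  lincomb-map {d = zero}  f-linear a b = IsLinearMap.map-0ᵛ f-linear
  lincomb-map {d = suc d} f-linear a b i =
    trans (map-+ᵛ _ _ i) (+-cong (map-·ᵛ (a zero) (b zero) i) (lincomb-map f-linear (a ∘ suc) (b ∘ suc) i))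
    where open IsLinearMap f-linear

  lincomb-closed : ∀ {n d p} (P : Vecᶠ n → Set p) → P 0ᵛ →
                   (∀ {u v} → P u → P v → P (u +ᵛ v)) → (∀ x {v} → P v → P (x ·ᵛ v)) →
                   (a : Fin d → Carrier) (b : Fin d → Vecᶠ n) → (∀ j → P (b j)) → P (lincomb a b)
  lincomb-closed {d = zero}  P P0 P+ P· a b Pb = P0
  lincomb-closed {d = suc d} P P0 P+ P· a b Pb =
    P+ (P· (a zero) (Pb zero)) (lincomb-closed P P0 P+ P· (a ∘ suc) (b ∘ suc) (Pb ∘ suc))

  lincomb-drop-zero : ∀ {n d} (a : Fin (suc d) → Carrier) (b : Fin (suc d) → Vecᶠ n) j → b j ≈ᵛ 0ᵛ →
                      lincomb a b ≈ᵛ lincomb (a ∘ punchIn j) (b ∘ punchIn j)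
  lincomb-drop-zero a b zero b₀≈0 i =
    trans (+-congʳ (trans (*-congˡ (b₀≈0 i)) (zeroʳ _))) (+-identityˡ _)
  lincomb-drop-zero {d = suc d} a b (suc j) bj≈0 i =
    +-congˡ (lincomb-drop-zero (a ∘ suc) (b ∘ suc) j bj≈0 i)

  tail-linear : ∀ {n} → IsLinearMap (tail {n = n})
  tail-linear = record { map-0ᵛ = λ _ → refl ; map-+ᵛ = λ _ _ _ → refl ; map-·ᵛ = λ _ _ _ → refl }

  -- One step of Gaussian elimination with pivot u and u₀⁻¹ = π: subtract the
  -- multiple of u that clears the first coordinate, then drop that coordinate.
  eliminate : ∀ {n} → Vecᶠ (suc n) → Carrier → Vecᶠ (suc n) → Vecᶠ n
  eliminate u π x i = tail x i - (head x * π) * tail u i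

  eliminate-linear : ∀ {n} (u : Vecᶠ (suc n)) π → IsLinearMap (eliminate u π)
  eliminate-linear u π = record
    { map-0ᵛ = λ i → trans (+-congˡ (-‿cong (trans (*-congʳ (zeroˡ π)) (zeroˡ _)))) (-‿inverseʳ 0#)
    ; map-+ᵛ = λ x y i → begin
        (tail x i + tail y i) - ((head x + head y) * π) * tail u i
          ≈⟨ +-congˡ (-‿cong (solve 4 (λ x₀ y₀ π t → ((x₀ :+ y₀) :* π) :* t := (x₀ :* π) :* t :+ (y₀ :* π) :* t)
                                        refl (head x) (head y) π (tail u i))) ⟩
        (tail x i + tail y i) - ((head x * π) * tail u i + (head y * π) * tail u i)
          ≈⟨ +-congˡ (-‿+-comm _ _) ⟨
        (tail x i + tail y i) + (- ((head x * π) * tail u i) + - ((head y * π) * tail u i))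
          ≈⟨ interchange _ _ _ _ ⟩
        (tail x i - (head x * π) * tail u i) + (tail y i - (head y * π) * tail u i) ∎
    ; map-·ᵛ = λ a x i → begin
        a * tail x i - ((a * head x) * π) * tail u i
          ≈⟨ +-congˡ (-‿cong (solve 4 (λ a x₀ π t → ((a :* x₀) :* π) :* t := a :* ((x₀ :* π) :* t))
                                        refl a (head x) π (tail u i))) ⟩
        a * tail x i - a * ((head x * π) * tail u i)   ≈⟨ +-congˡ (-‿distribʳ-* a _) ⟩
        a * tail x i + a * - ((head x * π) * tail u i) ≈⟨ distribˡ a _ _ ⟨
        a * (tail x i - (head x * π) * tail u i)       ∎
    }
    where open import Relation.Binary.Reasoning.Setoid setoid

  eliminate-cong : ∀ {n} (u : Vecᶠ (suc n)) π {x y} → x ≈ᵛ y → eliminate u π x ≈ᵛ eliminate u π y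
  eliminate-cong u π x≈y i = +-cong (x≈y (suc i)) (-‿cong (*-congʳ (*-congʳ (x≈y zero))))

  eliminate-pivot : ∀ {n} (u : Vecᶠ (suc n)) {π} → head u * π ≈ 1# → eliminate u π u ≈ᵛ 0ᵛ
  eliminate-pivot u u₀π≈1 i =
    trans (+-congˡ (-‿cong (trans (*-congʳ u₀π≈1) (*-identityˡ _)))) (-‿inverseʳ _)

  tail≈eliminate+pivot : ∀ {n} (u : Vecᶠ (suc n)) π x → tail x ≈ᵛ (eliminate u π x +ᵛ ((head x * π) ·ᵛ tail u))
  tail≈eliminate+pivot u π x i =
    sym (trans (+-assoc _ _ _) (trans (+-congˡ (-‿inverseˡ _)) (+-identityʳ _)))

  InAffineSpan : ∀ {n d} → Vecᶠ n → (Fin d → Vecᶠ n) → Vecᶠ n → Set (c ⊔ ℓ)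
  InAffineSpan w b v = Σ (Fin _ → Carrier) λ a → v ≈ᵛ (w +ᵛ lincomb a b)

  InSpan⇒InAffineSpan : ∀ {n d} {b : Fin d → Vecᶠ n} {v} → InSpan b v → InAffineSpan 0ᵛ b v
  InSpan⇒InAffineSpan (a , v≈) = a , λ i → trans (v≈ i) (sym (+-identityˡ _))

  tail-InAffineSpan : ∀ {n d} {w v : Vecᶠ (suc n)} {b : Fin d → Vecᶠ (suc n)} →
                      InAffineSpan w b v → InAffineSpan (tail w) (tail ∘ b) (tail v)
  tail-InAffineSpan {b = b} (a , v≈) = a , λ i → trans (v≈ (suc i)) (+-congˡ (lincomb-map tail-linear a b i))

  head-InAffineSpan : ∀ {n d} {w v : Vecᶠ (suc n)} {b : Fin d → Vecᶠ (suc n)} →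
                      (∀ j → head (b j) ≈ 0#) → InAffineSpan w b v → head v ≈ head w
  head-InAffineSpan {b = b} heads≈0 (a , v≈) =
    trans (v≈ zero) (trans (+-congˡ lincomb₀≈0) (+-identityʳ _))
    where
    lincomb₀≈0 : head (lincomb a b) ≈ 0#
    lincomb₀≈0 = lincomb-closed (λ x → head x ≈ 0#) refl
      (λ u₀≈0 v₀≈0 → trans (+-cong u₀≈0 v₀≈0) (+-identityʳ 0#))
      (λ x v₀≈0 → trans (*-congˡ v₀≈0) (zeroʳ x)) a b heads≈0

  eliminate-InAffineSpan : ∀ {n d} {w v : Vecᶠ (suc n)} {σ π} (b : Fin (suc d) → Vecᶠ (suc n)) j →
                           head (b j) * π ≈ 1# → InAffineSpan w b v → head v ≈ σ →
                           InAffineSpan (eliminate (b j) π w +ᵛ ((σ * π) ·ᵛ tail (b j)))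
                                        (eliminate (b j) π ∘ b ∘ punchIn j) (tail v)
  eliminate-InAffineSpan {n} {w = w} {v} {σ} {π} b j u₀π≈1 (a , v≈) v₀≈σ = a ∘ punchIn j , λ i → begin
    tail v i                           ≈⟨ tail≈eliminate+pivot u π v i ⟩
    E v i + (head v * π) * tail u i    ≈⟨ +-cong (Ev≈ i) (*-congʳ (*-congʳ v₀≈σ)) ⟩
    (E w i + R i) + (σ * π) * tail u i ≈⟨ xy∙z≈xz∙y _ _ _ ⟩
    (E w i + (σ * π) * tail u i) + R i ∎
    where
    open import Relation.Binary.Reasoning.Setoid setoid
    u : Vecᶠ (suc n)
    u = b j
    E : Vecᶠ (suc n) → Vecᶠ n
    E = eliminate u π
    R : Vecᶠ n
    R = lincomb (a ∘ punchIn j) (E ∘ b ∘ punchIn j)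
    open IsLinearMap (eliminate-linear u π)
    Ev≈ : E v ≈ᵛ (E w +ᵛ R)
    Ev≈ i = trans (eliminate-cong u π v≈ i)
            (trans (map-+ᵛ w (lincomb a b) i)
            (+-congˡ (trans (lincomb-map (eliminate-linear u π) a b i)
                            (lincomb-drop-zero a (E ∘ b) j (eliminate-pivot u u₀π≈1) i))))

  module _ (S : List Carrier) where

    s : ℕ
    s = length S

    InCube : ∀ {n} → Vecᶠ n → Set (c ⊔ ℓ)
    InCube v = ∀ i → Any (v i ≈_) S

    length-cube : ∀ n → length (cube S n) ≡ s ^ n
    length-cube zero    = ≡.refl
    length-cube (suc n) = ≡.trans (length-concatMap S) (≡.cong (s ℕ.*_) (length-cube n))
      where
      length-concatMap : ∀ S′ → length (concatMap (λ σ → map (σ VF.∷_) (cube S n)) S′) ≡ length S′ ℕ.* length (cube S n)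
      length-concatMap []       = ≡.refl
      length-concatMap (σ ∷ S′) = ≡.trans (length-++ (map (σ VF.∷_) (cube S n)))
                                    (≡.cong₂ ℕ._+_ (length-map (σ VF.∷_) (cube S n)) (length-concatMap S′))

    ∈-cube-suc⁻ : ∀ {n} {v : Vecᶠ (suc n)} → v ∈ᵛ cube S (suc n) → Any (head v ≈_) S × tail v ∈ᵛ cube S n
    ∈-cube-suc⁻ {n} v∈ = Any.map (λ v∈σ∷ → proj₂ (Any.satisfied (map⁻ v∈σ∷)) zero) (concatMap⁻ _ v∈)
                       , Any.map (λ v≈ i → v≈ (suc i)) (map⁻ (proj₂ (Any.satisfied (concatMap⁻ _ {xs = S} v∈))))

    ∈-cube⇒InCube : ∀ n {v : Vecᶠ n} → v ∈ᵛ cube S n → InCube v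
    ∈-cube⇒InCube (suc n) v∈ zero    = proj₁ (∈-cube-suc⁻ v∈)
    ∈-cube⇒InCube (suc n) v∈ (suc i) = ∈-cube⇒InCube n (proj₂ (∈-cube-suc⁻ v∈)) i

    distinct-length-≤1 : (L : List (Vecᶠ 0)) → Distinctᵛ L → length L ≤ 1
    distinct-length-≤1 []            _                 = z≤n
    distinct-length-≤1 (_ ∷ [])      _                 = s≤s z≤n
    distinct-length-≤1 (_ ∷ _ ∷ _)   ((u≉v ∷ _) ∷ _)   = ⊥-elim (u≉v λ ())

    tails-distinct : ∀ {n σ} {L : List (Vecᶠ (suc n))} → All (λ v → head v ≈ σ) L → Distinctᵛ L → Distinctᵛ (map tail L)
    tails-distinct []         []            = []
    tails-distinct (u₀≈σ ∷ heads) (u≉ ∷ distinct) =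
      map⁺ (All.zipWith (λ (v₀≈σ , u≉v) tail≈ → u≉v λ { zero → trans u₀≈σ (sym v₀≈σ) ; (suc i) → tail≈ i })
                        (heads , u≉))
      ∷ tails-distinct heads distinct

    cube-bound : ∀ n (L : List (Vecᶠ n)) → Distinctᵛ L → All InCube L → length L ≤ s ^ n
    cube-bound zero    L distinct _      = distinct-length-≤1 L distinct
    cube-bound (suc n) L distinct inCube =
      length-≤-fibres (λ σ v → head v ≈ σ) S L (All.map (λ v∈ → v∈ zero) inCube) λ σ {L′} L′⊆L heads →
        ≡.subst (_≤ s ^ n) (length-map tail L′)
          (cube-bound n (map tail L′) (tails-distinct heads (AllPairs-resp-⊆ L′⊆L distinct))
                                      (map⁺ (All.map (λ v∈ → v∈ ∘ suc) (All-resp-⊆ L′⊆L inCube))))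

    CubeAffineBound : ℕ → Set (c ⊔ ℓ)
    CubeAffineBound n = ∀ {d} (w : Vecᶠ n) (b : Fin d → Vecᶠ n) (L : List (Vecᶠ n)) → Distinctᵛ L →
                        All (λ v → InCube v × InAffineSpan w b v) L → length L ≤ s ^ d

    vanishing-heads-step : ∀ {n} → CubeAffineBound n → ∀ {d} (w : Vecᶠ (suc n)) (b : Fin d → Vecᶠ (suc n)) →
                           (∀ j → head (b j) ≈ 0#) → (L : List (Vecᶠ (suc n))) → Distinctᵛ L →
                           All (λ v → InCube v × InAffineSpan w b v) L → length L ≤ s ^ d
    vanishing-heads-step bound {d} w b heads≈0 L distinct members =
      ≡.subst (_≤ s ^ d) (length-map tail L)
        (bound (tail w) (tail ∘ b) (map tail L)
          (tails-distinct (All.map (head-InAffineSpan heads≈0 ∘ proj₂) members) distinct)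
          (map⁺ (All.map (λ (v∈ , v∈w+⟨b⟩) → v∈ ∘ suc , tail-InAffineSpan v∈w+⟨b⟩) members)))

    pivot-step : ∀ {n} → CubeAffineBound n → ∀ {d} (w : Vecᶠ (suc n)) (b : Fin d → Vecᶠ (suc n)) j →
                 ¬ head (b j) ≈ 0# → (L : List (Vecᶠ (suc n))) → Distinctᵛ L →
                 All (λ v → InCube v × InAffineSpan w b v) L → length L ≤ s ^ d
    pivot-step bound {suc d} w b j u₀≉0 L distinct members =
      length-≤-fibres (λ σ v → head v ≈ σ) S L (All.map (λ (v∈ , _) → v∈ zero) members) fibre
      where
      π : Carrier
      π = proj₁ (inverse (head (b j)) u₀≉0)
      u₀π≈1 : head (b j) * π ≈ 1#
      u₀π≈1 = proj₂ (inverse (head (b j)) u₀≉0)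
      fibre : ∀ σ {L′} → L′ ⊆ L → All (λ v → head v ≈ σ) L′ → length L′ ≤ s ^ d
      fibre σ {L′} L′⊆L heads =
        ≡.subst (_≤ s ^ d) (length-map tail L′)
          (bound (eliminate (b j) π w +ᵛ ((σ * π) ·ᵛ tail (b j))) (eliminate (b j) π ∘ b ∘ punchIn j) (map tail L′)
            (tails-distinct heads (AllPairs-resp-⊆ L′⊆L distinct))
            (map⁺ (All.zipWith (λ ((v∈ , v∈w+⟨b⟩) , v₀≈σ) → v∈ ∘ suc , eliminate-InAffineSpan b j u₀π≈1 v∈w+⟨b⟩ v₀≈σ)
                               (All-resp-⊆ L′⊆L members , heads))))

    cube∩affine-bound : ∀ n → .{{NonZero s}} → CubeAffineBound n
    cube∩affine-bound zero    {d} w b L distinct _ = ≤-trans (distinct-length-≤1 L distinct) (m^n>0 s d)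
    cube∩affine-bound (suc n) {d} w b L distinct members =
      decidable-stable (_ ≤? _) (¬¬-map
        [ (λ heads≈0 → vanishing-heads-step (cube∩affine-bound n) w b heads≈0 L distinct members)
        , (λ (j , u₀≉0) → pivot-step (cube∩affine-bound n) w b j u₀≉0 L distinct members) ]
        (¬¬-all-or-counterexample (λ j → head (b j) ≈ 0#)))

ℕ→ℚ≡mkℚ : ∀ m → ℕ→ℚ m ≡ mkℚ (+ m) 0 (Coprime.sym (Coprime.1-coprimeTo m))
ℕ→ℚ≡mkℚ m = ℚ.normalize-coprime (Coprime.sym (Coprime.1-coprimeTo m))

recipℕ≡mkℚ : ∀ k → recipℕ (suc k) ≡ mkℚ (+ 1) k (Coprime.1-coprimeTo (suc k))
recipℕ≡mkℚ k = ℚ.normalize-coprime (Coprime.1-coprimeTo (suc k))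

ℕ→ℚ-* : ∀ m n → ℕ→ℚ (m ℕ.* n) ≡ ℕ→ℚ m ℚ.* ℕ→ℚ n
ℕ→ℚ-* m n rewrite ℕ→ℚ≡mkℚ m | ℕ→ℚ≡mkℚ n = ≡.cong (ℚ._/ 1) (ℤ.pos-* m n)

ℕ→ℚ-mono-≤ : ∀ {m n} → m ≤ n → ℕ→ℚ m ℚ.≤ ℕ→ℚ n
ℕ→ℚ-mono-≤ {m} {n} m≤n rewrite ℕ→ℚ≡mkℚ m | ℕ→ℚ≡mkℚ n =
  ℚ.*≤* (≡.subst₂ ℤ._≤_ (≡.sym (ℤ.*-identityʳ (+ m))) (≡.sym (ℤ.*-identityʳ (+ n))) (ℤ.+≤+ m≤n))

recipℕ-inverseˡ : ∀ k → recipℕ (suc k) ℚ.* ℕ→ℚ (suc k) ≡ ℚ.1ℚ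
recipℕ-inverseˡ k = ≡.trans (≡.cong₂ ℚ._*_ (recipℕ≡mkℚ k) (ℕ→ℚ≡mkℚ (suc k)))
                            (ℚ.*-inverseˡ (mkℚ (+ suc k) 0 (Coprime.sym (Coprime.1-coprimeTo (suc k)))))

recipℕ^-inverseˡ : ∀ k t → (recipℕ (suc k) ^ℚ t) ℚ.* ℕ→ℚ (suc k ^ t) ≡ ℚ.1ℚ
recipℕ^-inverseˡ k zero    = ≡.refl
recipℕ^-inverseˡ k (suc t) = begin
  (r ℚ.* (r ^ℚ t)) ℚ.* ℕ→ℚ (suc k ℕ.* suc k ^ t)          ≡⟨ ≡.cong ((r ℚ.* (r ^ℚ t)) ℚ.*_) (ℕ→ℚ-* (suc k) (suc k ^ t)) ⟩
  (r ℚ.* (r ^ℚ t)) ℚ.* (ℕ→ℚ (suc k) ℚ.* ℕ→ℚ (suc k ^ t)) ≡⟨ ℚ-interchange r (r ^ℚ t) (ℕ→ℚ (suc k)) (ℕ→ℚ (suc k ^ t)) ⟩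
  (r ℚ.* ℕ→ℚ (suc k)) ℚ.* ((r ^ℚ t) ℚ.* ℕ→ℚ (suc k ^ t)) ≡⟨ ≡.cong₂ ℚ._*_ (recipℕ-inverseˡ k) (recipℕ^-inverseˡ k t) ⟩
  ℚ.1ℚ                                                     ∎
  where
  open ≡.≡-Reasoning
  open CommutativeSemigroupProperties (CommutativeMonoid.commutativeSemigroup ℚ.*-1-commutativeMonoid)
    renaming (interchange to ℚ-interchange)
  r : ℚ.ℚ
  r = recipℕ (suc k)

recipℕ^∸-scale : ∀ k {d n} → d ≤ n → (recipℕ (suc k) ^ℚ (n ∸ d)) ℚ.* ℕ→ℚ (suc k ^ n) ≡ ℕ→ℚ (suc k ^ d)
recipℕ^∸-scale k {d} {n} d≤n = begin
  (r ^ℚ t) ℚ.* ℕ→ℚ (suc k ^ n)                          ≡⟨ ≡.cong (λ e → (r ^ℚ t) ℚ.* ℕ→ℚ (suc k ^ e)) (m∸n+n≡m d≤n) ⟨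
  (r ^ℚ t) ℚ.* ℕ→ℚ (suc k ^ (t ℕ.+ d))                  ≡⟨ ≡.cong (λ e → (r ^ℚ t) ℚ.* ℕ→ℚ e) (^-distribˡ-+-* (suc k) t d) ⟩
  (r ^ℚ t) ℚ.* ℕ→ℚ (suc k ^ t ℕ.* suc k ^ d)            ≡⟨ ≡.cong ((r ^ℚ t) ℚ.*_) (ℕ→ℚ-* (suc k ^ t) (suc k ^ d)) ⟩
  (r ^ℚ t) ℚ.* (ℕ→ℚ (suc k ^ t) ℚ.* ℕ→ℚ (suc k ^ d))    ≡⟨ ℚ.*-assoc (r ^ℚ t) (ℕ→ℚ (suc k ^ t)) (ℕ→ℚ (suc k ^ d)) ⟨
  ((r ^ℚ t) ℚ.* ℕ→ℚ (suc k ^ t)) ℚ.* ℕ→ℚ (suc k ^ d)    ≡⟨ ≡.cong (ℚ._* ℕ→ℚ (suc k ^ d)) (recipℕ^-inverseˡ k t) ⟩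
  ℚ.1ℚ ℚ.* ℕ→ℚ (suc k ^ d)                              ≡⟨ ℚ.*-identityˡ _ ⟩
  ℕ→ℚ (suc k ^ d)                                       ∎
  where
  open ≡.≡-Reasoning
  r : ℚ.ℚ
  r = recipℕ (suc k)
  t : ℕ
  t = n ∸ d

count-≤-scaled : ∀ s .{{_ : NonZero s}} {m d n} → m ≤ s ^ d → m ≤ s ^ n →
                 ℕ→ℚ m ℚ.≤ (recipℕ s ^ℚ (n ∸ d)) ℚ.* ℕ→ℚ (s ^ n)
count-≤-scaled (suc k) {m} {d} {n} m≤s^d m≤s^n with d ≤? n
... | yes d≤n = ≡.subst (ℕ→ℚ m ℚ.≤_) (≡.sym (recipℕ^∸-scale k d≤n)) (ℕ→ℚ-mono-≤ m≤s^d)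
... | no  d≰n = ≡.subst (ℕ→ℚ m ℚ.≤_) (≡.sym scale-1) (ℕ→ℚ-mono-≤ m≤s^n)
  where
  scale-1 : (recipℕ (suc k) ^ℚ (n ∸ d)) ℚ.* ℕ→ℚ (suc k ^ n) ≡ ℕ→ℚ (suc k ^ n)
  scale-1 rewrite m≤n⇒m∸n≡0 (<⇒≤ (≰⇒> d≰n)) = ℚ.*-identityˡ _

lemma2p1 : ∀ {c ℓ : Level} (F : Field c ℓ) (n : ℕ) → 1 ≤ n →
    (S : List (Field.Carrier F)) → LinearAlgebra.Distinct F S → 2 ≤ length S →
    LinearAlgebra.Dispersed F (recipℕ (length S)) (LinearAlgebra.cube F S n)
lemma2p1 F n _ S _ 2≤s V _ d (b , _ , _ , spans) L distinct members =
  ≡.subst (λ N → ℕ→ℚ (length L) ℚ.≤ (recipℕ (length S) ^ℚ (n ∸ d)) ℚ.* ℕ→ℚ N) (≡.sym (length-cube F S n))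
    (count-≤-scaled (length S) {d = d} {n} within-span within-cube)
  where
  instance
    s≢0 : NonZero (length S)
    s≢0 = >-nonZero (≤-trans (s≤s z≤n) 2≤s)
  within-span : length L ≤ length S ^ d
  within-span = cube∩affine-bound F S n _ b L distinct
    (All.map (λ (v∈V , v∈cube) → ∈-cube⇒InCube F S n v∈cube , InSpan⇒InAffineSpan F (spans _ v∈V)) members)
  within-cube : length L ≤ length S ^ n
  within-cube = cube-bound F S n L distinct (All.map (∈-cube⇒InCube F S n ∘ proj₂) members)
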